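{- $[\![a\to b]\!]'_{(a,b)\in\mathscr{A}^2}=[\![\pi_{\mathscr{A}}]\!]'_{\mathscr{A}^2}\to[\![\pi'_{\mathscr{A}}]\!]'_{\mathscr{A}^2}$ in $\mathsf{P}(\mathscr{A}\times\mathscr{A})$, where $\pi_{\mathscr{A}},\pi'_{\mathscr{A}}:\mathscr{A}^2\to\mathscr{A}$ are the two projections.
   Context: $\mathsf{P}:\mathbf{Set}^{\mathrm{op}}\to\mathbf{HA}$ is a $\mathbf{Set}$-based tripos: a functor into Heyting algebras such that (1) each $\mathsf{P}f:\mathsf{P}Y\to\mathsf{P}X$ ($f:X\to Y$) has a left adjoint $\exists f$ and right adjoint $\forall f$ among monotone maps $\mathsf{P}X\to\mathsf{P}Y$; (2) for every pullback square in $\mathbf{Set}$ with $f_1:X\to X_1,f_2:X\to X_2,g_1:X_1\to Y,g_2:X_2\to Y$, $\exists f_1\circ\mathsf{P}f_2=\mathsf{P}g_1\circ\exists g_2$ and $\forall f_1\circ\mathsf{P}f_2=\mathsf{P}g_1\circ\forall g_2$; (3) there is a set $\Sigma$ and $\mathrm{tr}_\Sigma\in\mathsf{P}\Sigma$ with $\sigma\mapsto\mathsf{P}\sigma(\mathrm{tr}_\Sigma)$, $\Sigma^X\to\mathsf{P}X$, surjective for every set $X$. Fix these; for $\sigma\in\Sigma^X$ write $[\![\sigma]\!]_X:=\mathsf{P}\sigma(\mathrm{tr}_\Sigma)$. Let $\pi,\pi'$ be the projections $\Sigma\times\Sigma\to\Sigma$ and $\dot\to:\Sigma\times\Sigma\to\Sigma$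 (infix) any map with $[\![\dot\to]\!]_{\Sigma\times\Sigma}=[\![\pi]\!]_{\Sigma\times\Sigma}\to[\![\pi']\!]_{\Sigma\times\Sigma}$. Let $E=\{(\xi,s)\in\Sigma\times\mathfrak{P}(\Sigma):\xi\in s\}$ with projections $e_1,e_2$, and $\dot\bigwedge:\mathfrak{P}(\Sigma)\to\Sigma$ any map with $[\![\dot\bigwedge]\!]_{\mathfrak{P}(\Sigma)}=\forall e_2([\![e_1]\!]_E)$. Let $\mathscr{A}_0$ be the set of atoms inductively generated by: an atom $\dot\xi$ for each $\xi\in\Sigma$, and an atom $(s\mapsto\alpha)$ for each $s\subseteq\Sigma$, $\alpha\in\mathscr{A}_0$. The preorder $\le$ on $\mathscr{A}_0$ is inductively generated by $\dot\xi\le\dot\xi$ and: $s\subseteq s'$, $\alpha\le\alpha'$ imply $(s\mapsto\alpha)\le(s'\mapsto\alpha')$. Define $\phi_0:\mathscr{A}_0\to\Sigma$ by $\phi_0(\dot\xi)=\xi$, $\phi_0(s\mapsto\alpha)=(\dot\bigwedge s)\mathbin{\dot\to}\phi_0(\alpha)$. Let $\mathscr{A}$ be the set of upward closed subsets of $(\mathscr{A}_0,\le)$. For $a\in\mathscr{A}$ let $\tilde\phi_0(a)=\{\phi_0(\alpha):\alpha\in a\}$ and for $a,b\in\mathscr{A}$ let $a\to b=\{s\mapsto\beta:s\subseteq\Sigma,\ \tilde\phi_0(a)\subseteq s,\ \beta\in b\}$. Define $\phi:\mathscr{A}\to\Sigma$ by $\phi(a)=\dot\bigwedge\tilde\phi_0(a)$,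 $\mathrm{tr}_{\mathscr{A}}:=\mathsf{P}\phi(\mathrm{tr}_\Sigma)\in\mathsf{P}\mathscr{A}$, and for $a\in\mathscr{A}^X$, $[\![a]\!]'_X=[\![a_x]\!]'_{x\in X}:=\mathsf{P}a(\mathrm{tr}_{\mathscr{A}})$. The axiom of choice is assumed. -}

module Defs where

open import Level using (Level; _⊔_; suc)
open import Data.Bool using (Bool; true; false)
open import Data.Product using (Σ; ∃; _×_; _,_; proj₁; proj₂)
open import Function using (_∘_; id)
open import Relation.Binary.PropositionalEquality using (_≡_; refl; _≗_)
open import Relation.Nullary using (Dec; yes; no; does)
open import Relation.Binary.Lattice.Bundles using (HeytingAlgebra)
open import Axiom.Extensionality.Propositional using (Extensionality)

-- Classical metatheory: excluded middle for types of level ℓ (the paper works in ZFC).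
LEM : (ℓ : Level) → Set (suc ℓ)
LEM ℓ = (A : Set ℓ) → Dec A

record IsPullback {ℓ} {X X₁ X₂ Y : Set ℓ}
                  (f₁ : X → X₁) (f₂ : X → X₂) (g₁ : X₁ → Y) (g₂ : X₂ → Y) : Set (suc ℓ) where
  field
    commutes  : g₁ ∘ f₁ ≗ g₂ ∘ f₂
    mediate   : {Z : Set ℓ} (h₁ : Z → X₁) (h₂ : Z → X₂) → g₁ ∘ h₁ ≗ g₂ ∘ h₂ →
                Σ (Z → X) λ u → (f₁ ∘ u ≗ h₁) × (f₂ ∘ u ≗ h₂)
    unique    : {Z : Set ℓ} (u v : Z → X) → f₁ ∘ u ≗ f₁ ∘ v → f₂ ∘ u ≗ f₂ ∘ v → u ≗ v

record Tripos (ℓ c ℓ₁ ℓ₂ : Level) : Set (suc (ℓ ⊔ c ⊔ ℓ₁ ⊔ ℓ₂)) where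
  field
    P : Set ℓ → HeytingAlgebra c ℓ₁ ℓ₂
  module H (X : Set ℓ) = HeytingAlgebra (P X)
  field
    Pm       : {X Y : Set ℓ} → (X → Y) → H.Carrier Y → H.Carrier X
    Pm-resp-≗ : {X Y : Set ℓ} {f g : X → Y} → f ≗ g → (φ : H.Carrier Y) → H._≈_ X (Pm f φ) (Pm g φ)
    Pm-cong  : {X Y : Set ℓ} (f : X → Y) {φ ψ : H.Carrier Y} → H._≈_ Y φ ψ → H._≈_ X (Pm f φ) (Pm f ψ)
    Pm-id    : {X : Set ℓ} (φ : H.Carrier X) → H._≈_ X (Pm id φ) φ
    Pm-∘     : {X Y Z : Set ℓ} (f : X → Y) (g : Y → Z) (φ : H.Carrier Z) →
               H._≈_ X (Pm (g ∘ f) φ) (Pm f (Pm g φ))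
    Pm-⊤     : {X Y : Set ℓ} (f : X → Y) → H._≈_ X (Pm f (H.⊤ Y)) (H.⊤ X)
    Pm-⊥     : {X Y : Set ℓ} (f : X → Y) → H._≈_ X (Pm f (H.⊥ Y)) (H.⊥ X)
    Pm-∧     : {X Y : Set ℓ} (f : X → Y) (φ ψ : H.Carrier Y) →
               H._≈_ X (Pm f (H._∧_ Y φ ψ)) (H._∧_ X (Pm f φ) (Pm f ψ))
    Pm-∨     : {X Y : Set ℓ} (f : X → Y) (φ ψ : H.Carrier Y) →
               H._≈_ X (Pm f (H._∨_ Y φ ψ)) (H._∨_ X (Pm f φ) (Pm f ψ))
    Pm-⇨     : {X Y : Set ℓ} (f : X → Y) (φ ψ : H.Carrier Y) →
               H._≈_ X (Pm f (H._⇨_ Y φ ψ)) (H._⇨_ X (Pm f φ) (Pm f ψ))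
    ∃m       : {X Y : Set ℓ} → (X → Y) → H.Carrier X → H.Carrier Y
    ∀m       : {X Y : Set ℓ} → (X → Y) → H.Carrier X → H.Carrier Y
    ∃m-mono  : {X Y : Set ℓ} (f : X → Y) {φ ψ : H.Carrier X} → H._≤_ X φ ψ → H._≤_ Y (∃m f φ) (∃m f ψ)
    ∀m-mono  : {X Y : Set ℓ} (f : X → Y) {φ ψ : H.Carrier X} → H._≤_ X φ ψ → H._≤_ Y (∀m f φ) (∀m f ψ)
    ∃⊣P₁     : {X Y : Set ℓ} (f : X → Y) (φ : H.Carrier X) (ψ : H.Carrier Y) →
               H._≤_ Y (∃m f φ) ψ → H._≤_ X φ (Pm f ψ)
    ∃⊣P₂     : {X Y : Set ℓ} (f : X → Y) (φ : H.Carrier X) (ψ : H.Carrier Y) →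
               H._≤_ X φ (Pm f ψ) → H._≤_ Y (∃m f φ) ψ
    P⊣∀₁     : {X Y : Set ℓ} (f : X → Y) (ψ : H.Carrier Y) (φ : H.Carrier X) →
               H._≤_ X (Pm f ψ) φ → H._≤_ Y ψ (∀m f φ)
    P⊣∀₂     : {X Y : Set ℓ} (f : X → Y) (ψ : H.Carrier Y) (φ : H.Carrier X) →
               H._≤_ Y ψ (∀m f φ) → H._≤_ X (Pm f ψ) φ
    BC-∃     : {X X₁ X₂ Y : Set ℓ} (f₁ : X → X₁) (f₂ : X → X₂) (g₁ : X₁ → Y) (g₂ : X₂ → Y) →
               IsPullback f₁ f₂ g₁ g₂ → (φ : H.Carrier X₂) →
               H._≈_ X₁ (∃m f₁ (Pm f₂ φ)) (Pm g₁ (∃m g₂ φ))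
    BC-∀     : {X X₁ X₂ Y : Set ℓ} (f₁ : X → X₁) (f₂ : X → X₂) (g₁ : X₁ → Y) (g₂ : X₂ → Y) →
               IsPullback f₁ f₂ g₁ g₂ → (φ : H.Carrier X₂) →
               H._≈_ X₁ (∀m f₁ (Pm f₂ φ)) (Pm g₁ (∀m g₂ φ))
    Sig      : Set ℓ
    trΣ      : H.Carrier Sig
    generic  : {X : Set ℓ} (φ : H.Carrier X) → Σ (X → Sig) λ σ → H._≈_ X (Pm σ trΣ) φ

  ⟦_⟧ : {X : Set ℓ} → (X → Sig) → H.Carrier X
  ⟦ σ ⟧ = Pm σ trΣ

-- Subsets of a set, 𝔓(A), represented as Bool-valued characteristic functions
-- (equivalent to the power set in the classical metatheory, given LEM and funext).
𝔓 : ∀ {ℓ} → Set ℓ → Set ℓ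
𝔓 A = A → Bool

_⊆_ : ∀ {ℓ} {A : Set ℓ} → 𝔓 A → 𝔓 A → Set ℓ
s ⊆ t = ∀ ξ → s ξ ≡ true → t ξ ≡ true

does-true→ : ∀ {ℓ} {A : Set ℓ} (d : Dec A) → does d ≡ true → A
does-true→ (yes a) _ = a
does-true→ (no _) ()

→does-true : ∀ {ℓ} {A : Set ℓ} (d : Dec A) → A → does d ≡ true
→does-true (yes _) _ = refl
→does-true (no ¬a) a with ¬a a
... | ()

module Construction {ℓ c ℓ₁ ℓ₂ : Level} (T : Tripos ℓ c ℓ₁ ℓ₂) (lem : LEM ℓ)
                    (_→̇_ : Tripos.Sig T × Tripos.Sig T → Tripos.Sig T)
                    (⋀̇ : 𝔓 (Tripos.Sig T) → Tripos.Sig T) where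
  open Tripos T

  E : Set ℓ
  E = Σ (Sig × 𝔓 Sig) λ p → proj₂ p (proj₁ p) ≡ true

  e₁ : E → Sig
  e₁ = proj₁ ∘ proj₁

  e₂ : E → 𝔓 Sig
  e₂ = proj₂ ∘ proj₁

  data Atom : Set ℓ where
    dot : Sig → Atom
    _↦_ : 𝔓 Sig → Atom → Atom

  data _≤A_ : Atom → Atom → Set ℓ where
    dot≤ : (ξ : Sig) → dot ξ ≤A dot ξ
    ↦≤   : {s s' : 𝔓 Sig} {α α' : Atom} → s ⊆ s' → α ≤A α' → (s ↦ α) ≤A (s' ↦ α')

  φ₀ : Atom → Sig
  φ₀ (dot ξ) = ξ
  φ₀ (s ↦ α) = _→̇_ (⋀̇ s , φ₀ α)

  record 𝒜 : Set ℓ where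
    constructor mk𝒜
    field
      mem : 𝔓 Atom
      up  : {α β : Atom} → α ≤A β → mem α ≡ true → mem β ≡ true
  open 𝒜 public

  φ̃₀ : 𝒜 → 𝔓 Sig
  φ̃₀ a ξ = does (lem (Σ Atom λ α → (mem a α ≡ true) × (φ₀ α ≡ ξ)))

  arrowMem : 𝒜 → 𝒜 → 𝔓 Atom
  arrowMem a b (dot _) = false
  arrowMem a b (s ↦ β) = does (lem ((φ̃₀ a ⊆ s) × (mem b β ≡ true)))

  arrowUp : (a b : 𝒜) {α β : Atom} → α ≤A β → arrowMem a b α ≡ true → arrowMem a b β ≡ true
  arrowUp a b (dot≤ ξ) h = h
  arrowUp a b (↦≤ {s} {s'} {α} {α'} s⊆s' α≤α') h with does-true→ (lem _) h
  ... | (φa⊆s , α∈b) =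
    →does-true (lem _) ((λ ξ p → s⊆s' ξ (φa⊆s ξ p)) , up b α≤α' α∈b)

  _⟶_ : 𝒜 → 𝒜 → 𝒜
  a ⟶ b = mk𝒜 (arrowMem a b) (arrowUp a b)

  φ : 𝒜 → Sig
  φ a = ⋀̇ (φ̃₀ a)

  tr𝒜 : H.Carrier 𝒜
  tr𝒜 = Pm φ trΣ

  ⟦_⟧' : {X : Set ℓ} → (X → 𝒜) → H.Carrier X
  ⟦ a ⟧' = Pm a tr𝒜

-- In the tripos, ⋀̇ S is the internal infimum ∀ξ ∈ S. ξ: Beck–Chevalley along the pullback
-- of e₂ by S, whose apex is the incidence set {(x, ξ) : ξ ∈ S x}, turns the hypothesis on ⋀̇
-- into ⟦⋀̇ ∘ S⟧ ≈ ∀(⟦ξ⟧ over that set). Since ⟦a⟧' = ⟦⋀̇ φ̃₀(a)⟧, the truth value of a ⟶ b is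
-- the infimum of ⋀̇ s ⇨ φ₀ β over s ⊇ φ̃₀(a) and β ∈ b. Taking s = φ̃₀(a) gives ≤ after
-- quantifying over β; for ≥, every such s has ⋀̇ s ≤ ⟦a⟧' (⋀̇ is antitone) and ⟦b⟧' ≤ φ₀ β,
-- so ⟦a⟧' ⇨ ⟦b⟧' ≤ ⋀̇ s ⇨ φ₀ β by the variance of ⇨.
module Submission where

open import Defs
open import Level using (Level)
open import Data.Bool using (true)
import Data.Bool as Bool
open import Data.Product using (Σ; _×_; _,_; proj₁; proj₂)
open import Function using (_∘_; id)
open import Relation.Binary.PropositionalEquality using (_≡_; refl; cong; trans; _≗_)
open import Relation.Binary.Lattice.Bundles using (HeytingAlgebra)
open import Axiom.Extensionality.Propositional using (Extensionality)
open import Axiom.UniquenessOfIdentityProofs using (module Decidable⇒UIP)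
import Relation.Binary.Lattice.Properties.HeytingAlgebra as HeytingAlgebraProperties
import Relation.Binary.Lattice.Properties.MeetSemilattice as MeetSemilatticeProperties
import Relation.Binary.Reasoning.PartialOrder as PosetReasoning

module TriposProperties {ℓ c ℓ₁ ℓ₂ : Level} (T : Tripos ℓ c ℓ₁ ℓ₂) where
  open Tripos T

  module L (X : Set ℓ) where
    open HeytingAlgebra (P X) public renaming (refl to ≤-refl)
    open HeytingAlgebraProperties (P X) public using (⇨-eval; ⇨-cong; ⇨-relax)
    open MeetSemilatticeProperties meetSemilattice public using (∧-monotonic; ∧-cong)
    open PosetReasoning poset public

  Pm-mono : {X Y : Set ℓ} (f : X → Y) {φ ψ : H.Carrier Y} →
            H._≤_ Y φ ψ → H._≤_ X (Pm f φ) (Pm f ψ)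
  Pm-mono {X} {Y} f {φ} {ψ} φ≤ψ =
    P⊣∀₂ f φ (Pm f ψ) (L.trans Y φ≤ψ (P⊣∀₁ f ψ (Pm f ψ) (L.≤-refl X)))

  ∀m-cong : {X Y : Set ℓ} (f : X → Y) {φ ψ : H.Carrier X} →
            H._≈_ X φ ψ → H._≈_ Y (∀m f φ) (∀m f ψ)
  ∀m-cong {X} {Y} f φ≈ψ =
    L.antisym Y (∀m-mono f (L.reflexive X φ≈ψ)) (∀m-mono f (L.reflexive X (L.Eq.sym X φ≈ψ)))

  Pm-⟦⟧ : {X Y : Set ℓ} (g : X → Y) (σ : Y → Sig) → H._≈_ X (Pm g ⟦ σ ⟧) ⟦ σ ∘ g ⟧
  Pm-⟦⟧ {X} g σ = L.Eq.sym X (Pm-∘ g σ trΣ)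

  ⟦→̇⟧-reindex : (_→̇_ : Sig × Sig → Sig) →
                H._≈_ (Sig × Sig) ⟦ _→̇_ ⟧ (H._⇨_ (Sig × Sig) ⟦ proj₁ ⟧ ⟦ proj₂ ⟧) →
                {X : Set ℓ} (k : X → Sig × Sig) →
                H._≈_ X ⟦ _→̇_ ∘ k ⟧ (H._⇨_ X ⟦ proj₁ ∘ k ⟧ ⟦ proj₂ ∘ k ⟧)
  ⟦→̇⟧-reindex _→̇_ ⟦→̇⟧≈⇨ {X} k = begin-equality
    ⟦ _→̇_ ∘ k ⟧                                   ≈⟨ Pm-∘ k _→̇_ trΣ ⟩
    Pm k ⟦ _→̇_ ⟧                                  ≈⟨ Pm-cong k ⟦→̇⟧≈⇨ ⟩
    Pm k (H._⇨_ (Sig × Sig) ⟦ proj₁ ⟧ ⟦ proj₂ ⟧)  ≈⟨ Pm-⇨ k _ _ ⟩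
    Pm k ⟦ proj₁ ⟧ ⇨ Pm k ⟦ proj₂ ⟧               ≈⟨ ⇨-cong (Pm-⟦⟧ k proj₁) (Pm-⟦⟧ k proj₂) ⟩
    ⟦ proj₁ ∘ k ⟧ ⇨ ⟦ proj₂ ∘ k ⟧                 ∎
    where open L X

module InternalMeet {ℓ c ℓ₁ ℓ₂ : Level} (T : Tripos ℓ c ℓ₁ ℓ₂) (lem : LEM ℓ)
    (_→̇_ : Tripos.Sig T × Tripos.Sig T → Tripos.Sig T)
    (⋀̇ : 𝔓 (Tripos.Sig T) → Tripos.Sig T)
    (⟦⋀̇⟧≈∀ : Tripos.H._≈_ T (𝔓 (Tripos.Sig T)) (Tripos.⟦_⟧ T ⋀̇)
      (Tripos.∀m T (Construction.e₂ T lem _→̇_ ⋀̇) (Tripos.⟦_⟧ T (Construction.e₁ T lem _→̇_ ⋀̇))))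
    where
  open Tripos T
  open Construction T lem _→̇_ ⋀̇ using (E; e₁; e₂)
  open TriposProperties T

  Incidence : {X : Set ℓ} → (X → 𝔓 Sig) → Set ℓ
  Incidence {X} S = Σ (X × Sig) λ p → S (proj₁ p) (proj₂ p) ≡ true

  module _ {X : Set ℓ} (S : X → 𝔓 Sig) where

    index : Incidence S → X
    index = proj₁ ∘ proj₁

    element : Incidence S → Sig
    element = proj₂ ∘ proj₁

    toE : Incidence S → E
    toE w = (element w , S (index w)) , proj₂ w

    incidence-pullback : IsPullback index toE S e₂
    incidence-pullback = record
      { commutes = λ _ → refl
      ; mediate  = λ h₁ h₂ eq → (λ z → (h₁ z , e₁ (h₂ z)) , ∈-transport h₂ (eq z))
                              , (λ _ → refl) , (λ z → toE-mediate h₁ h₂ (eq z))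
      ; unique   = unique
      }
      where
      ∈-transport : {Z : Set ℓ} (h₂ : Z → E) {z : Z} {s : 𝔓 Sig} →
                    s ≡ e₂ (h₂ z) → s (e₁ (h₂ z)) ≡ true
      ∈-transport h₂ {z} s≡ = trans (cong (λ t → t (e₁ (h₂ z))) s≡) (proj₂ (h₂ z))

      toE-mediate : {Z : Set ℓ} (h₁ : Z → X) (h₂ : Z → E) {z : Z} (eq : S (h₁ z) ≡ e₂ (h₂ z)) →
                    ((e₁ (h₂ z) , S (h₁ z)) , ∈-transport h₂ eq) ≡ h₂ z
      toE-mediate h₁ h₂ {z} eq with h₂ z | eq
      ... | (ξ , s) , _ | refl = cong ((ξ , s) ,_) (Decidable⇒UIP.≡-irrelevant Bool._≟_ _ _)

      unique : {Z : Set ℓ} (u v : Z → Incidence S) →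
               index ∘ u ≗ index ∘ v → toE ∘ u ≗ toE ∘ v → u ≗ v
      unique u v index-eq toE-eq z with u z | v z | index-eq z | toE-eq z
      ... | (x , ξ) , _ | (.x , .ξ) , _ | refl | refl = refl

    ⟦⋀̇∘⟧≈∀ : H._≈_ X ⟦ ⋀̇ ∘ S ⟧ (∀m index ⟦ element ⟧)
    ⟦⋀̇∘⟧≈∀ = begin-equality
      ⟦ ⋀̇ ∘ S ⟧                 ≈⟨ Pm-∘ S ⋀̇ trΣ ⟩
      Pm S ⟦ ⋀̇ ⟧                ≈⟨ Pm-cong S ⟦⋀̇⟧≈∀ ⟩
      Pm S (∀m e₂ ⟦ e₁ ⟧)       ≈⟨ BC-∀ index toE S e₂ incidence-pullback ⟦ e₁ ⟧ ⟨
      ∀m index (Pm toE ⟦ e₁ ⟧)  ≈⟨ ∀m-cong index (Pm-⟦⟧ toE e₁) ⟩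
      ∀m index ⟦ element ⟧      ∎
      where open L X

    ⋀̇-greatest : (ψ : H.Carrier X) →
                 H._≤_ (Incidence S) (Pm index ψ) ⟦ element ⟧ → H._≤_ X ψ ⟦ ⋀̇ ∘ S ⟧
    ⋀̇-greatest ψ Pψ≤element =
      L.trans X (P⊣∀₁ index ψ ⟦ element ⟧ Pψ≤element) (L.reflexive X (L.Eq.sym X ⟦⋀̇∘⟧≈∀))

    ⋀̇-lowerBound : (σ : X → Sig) → (∀ x → S x (σ x) ≡ true) → H._≤_ X ⟦ ⋀̇ ∘ S ⟧ ⟦ σ ⟧
    ⋀̇-lowerBound σ σ∈S = begin
      ⟦ ⋀̇ ∘ S ⟧                     ≈⟨ Pm-id _ ⟨
      Pm id ⟦ ⋀̇ ∘ S ⟧               ≈⟨ Pm-∘ pick index _ ⟩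
      Pm pick (Pm index ⟦ ⋀̇ ∘ S ⟧)  ≤⟨ Pm-mono pick (P⊣∀₂ index _ _ (reflexive ⟦⋀̇∘⟧≈∀)) ⟩
      Pm pick ⟦ element ⟧           ≈⟨ Pm-⟦⟧ pick element ⟩
      ⟦ σ ⟧                         ∎
      where
      open L X
      pick : X → Incidence S
      pick x = (x , σ x) , σ∈S x

  ⋀̇-antitone : {X : Set ℓ} (S S′ : X → 𝔓 Sig) → (∀ x → S x ⊆ S′ x) →
               H._≤_ X ⟦ ⋀̇ ∘ S′ ⟧ ⟦ ⋀̇ ∘ S ⟧
  ⋀̇-antitone S S′ S⊆S′ = ⋀̇-greatest S ⟦ ⋀̇ ∘ S′ ⟧ (begin
    Pm (index S) ⟦ ⋀̇ ∘ S′ ⟧  ≈⟨ Pm-⟦⟧ (index S) (⋀̇ ∘ S′) ⟩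
    ⟦ ⋀̇ ∘ S′ ∘ index S ⟧     ≤⟨ ⋀̇-lowerBound (S′ ∘ index S) (element S)
                               (λ w → S⊆S′ (index S w) (element S w) (proj₂ w)) ⟩
    ⟦ element S ⟧            ∎)
    where open L (Incidence S)

module ArrowMembership {ℓ c ℓ₁ ℓ₂ : Level} (T : Tripos ℓ c ℓ₁ ℓ₂) (lem : LEM ℓ)
    (_→̇_ : Tripos.Sig T × Tripos.Sig T → Tripos.Sig T)
    (⋀̇ : 𝔓 (Tripos.Sig T) → Tripos.Sig T) where
  open Tripos T using (Sig)
  open Construction T lem _→̇_ ⋀̇

  φ₀∈φ̃₀ : (a : 𝒜) {α : Atom} → mem a α ≡ true → φ̃₀ a (φ₀ α) ≡ true
  φ₀∈φ̃₀ a {α} α∈a = →does-true (lem _) (α , α∈a , refl)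

  ↦∈⟶ : (a b : 𝒜) {s : 𝔓 Sig} {β : Atom} →
        φ̃₀ a ⊆ s → mem b β ≡ true → mem (a ⟶ b) (s ↦ β) ≡ true
  ↦∈⟶ a b φ̃₀a⊆s β∈b = →does-true (lem _) (φ̃₀a⊆s , β∈b)

  record ⟶-Witness (a b : 𝒜) (ξ : Sig) : Set ℓ where
    field
      dom        : 𝔓 Sig
      cod        : Atom
      φ̃₀a⊆dom    : φ̃₀ a ⊆ dom
      cod∈b      : mem b cod ≡ true
      ξ-is-arrow : _→̇_ (⋀̇ dom , φ₀ cod) ≡ ξ

  φ̃₀-⟶-witness : (a b : 𝒜) (ξ : Sig) → φ̃₀ (a ⟶ b) ξ ≡ true → ⟶-Witness a b ξ
  φ̃₀-⟶-witness a b ξ ξ∈ with does-true→ (lem _) ξ∈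
  ... | dot _ , () , _
  ... | s ↦ β , s↦β∈a⟶b , refl with does-true→ (lem _) s↦β∈a⟶b
  ...   | φ̃₀a⊆s , β∈b = record
    { dom = s ; cod = β ; φ̃₀a⊆dom = φ̃₀a⊆s ; cod∈b = β∈b ; ξ-is-arrow = refl }

module ArrowRealizability {ℓ c ℓ₁ ℓ₂ : Level} (T : Tripos ℓ c ℓ₁ ℓ₂) (lem : LEM ℓ)
    (_→̇_ : Tripos.Sig T × Tripos.Sig T → Tripos.Sig T)
    (⟦→̇⟧≈⇨ : Tripos.H._≈_ T (Tripos.Sig T × Tripos.Sig T) (Tripos.⟦_⟧ T _→̇_)
      (Tripos.H._⇨_ T (Tripos.Sig T × Tripos.Sig T) (Tripos.⟦_⟧ T proj₁) (Tripos.⟦_⟧ T proj₂)))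
    (⋀̇ : 𝔓 (Tripos.Sig T) → Tripos.Sig T)
    (⟦⋀̇⟧≈∀ : Tripos.H._≈_ T (𝔓 (Tripos.Sig T)) (Tripos.⟦_⟧ T ⋀̇)
      (Tripos.∀m T (Construction.e₂ T lem _→̇_ ⋀̇) (Tripos.⟦_⟧ T (Construction.e₁ T lem _→̇_ ⋀̇))))
    where
  open Tripos T
  open Construction T lem _→̇_ ⋀̇
  open TriposProperties T
  open InternalMeet T lem _→̇_ ⋀̇ ⟦⋀̇⟧≈∀
  open ArrowMembership T lem _→̇_ ⋀̇

  module _ {X : Set ℓ} (a b : X → 𝒜) where

    private
      a⟶b : X → 𝒜
      a⟶b x = a x ⟶ b x

    ⟦φ∘⟶⟧≤⇨ : H._≤_ X ⟦ φ ∘ a⟶b ⟧ (H._⇨_ X ⟦ φ ∘ a ⟧ ⟦ φ ∘ b ⟧)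
    ⟦φ∘⟶⟧≤⇨ = L.transpose-⇨ X (⋀̇-greatest (φ̃₀ ∘ b) _ (begin
      Pm ι (⟦ φ ∘ a⟶b ⟧ X.∧ ⟦ φ ∘ a ⟧)                        ≈⟨ Pm-∧ ι _ _ ⟩
      Pm ι ⟦ φ ∘ a⟶b ⟧ ∧ Pm ι ⟦ φ ∘ a ⟧                       ≈⟨ ∧-cong (Pm-⟦⟧ ι (φ ∘ a⟶b)) (Pm-⟦⟧ ι (φ ∘ a)) ⟩
      ⟦ φ ∘ a⟶b ∘ ι ⟧ ∧ ⟦ φ ∘ a ∘ ι ⟧                         ≤⟨ ∧-monotonic (⋀̇-lowerBound (φ̃₀ ∘ a⟶b ∘ ι) (_→̇_ ∘ k) arrow∈φ̃₀) ≤-refl ⟩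
      ⟦ _→̇_ ∘ k ⟧ ∧ ⟦ φ ∘ a ∘ ι ⟧                             ≈⟨ ∧-cong (⟦→̇⟧-reindex _→̇_ ⟦→̇⟧≈⇨ k) Eq.refl ⟩
      (⟦ φ ∘ a ∘ ι ⟧ ⇨ ⟦ element (φ̃₀ ∘ b) ⟧) ∧ ⟦ φ ∘ a ∘ ι ⟧  ≤⟨ ⇨-eval ⟩
      ⟦ element (φ̃₀ ∘ b) ⟧                                    ∎))
      where
      ι : Incidence (φ̃₀ ∘ b) → X
      ι = index (φ̃₀ ∘ b)
      module X = L X
      open L (Incidence (φ̃₀ ∘ b))
      k : Incidence (φ̃₀ ∘ b) → Sig × Sig
      k w = φ (a (ι w)) , element (φ̃₀ ∘ b) w
      arrow∈φ̃₀ : ∀ w → φ̃₀ (a⟶b (ι w)) (_→̇_ (k w)) ≡ true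
      arrow∈φ̃₀ w with does-true→ (lem _) (proj₂ w)
      ... | β , β∈b , refl = φ₀∈φ̃₀ (a⟶b (ι w)) (↦∈⟶ (a (ι w)) (b (ι w)) (λ _ ξ∈ → ξ∈) β∈b)

    ⇨≤⟦φ∘⟶⟧ : H._≤_ X (H._⇨_ X ⟦ φ ∘ a ⟧ ⟦ φ ∘ b ⟧) ⟦ φ ∘ a⟶b ⟧
    ⇨≤⟦φ∘⟶⟧ = ⋀̇-greatest (φ̃₀ ∘ a⟶b) _ (begin
      Pm ι (⟦ φ ∘ a ⟧ X.⇨ ⟦ φ ∘ b ⟧)            ≈⟨ Pm-⇨ ι _ _ ⟩
      Pm ι ⟦ φ ∘ a ⟧ ⇨ Pm ι ⟦ φ ∘ b ⟧           ≈⟨ ⇨-cong (Pm-⟦⟧ ι (φ ∘ a)) (Pm-⟦⟧ ι (φ ∘ b)) ⟩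
      ⟦ φ ∘ a ∘ ι ⟧ ⇨ ⟦ φ ∘ b ∘ ι ⟧             ≤⟨ ⇨-relax dom-bound cod-bound ⟩
      ⟦ ⋀̇ ∘ dom ⟧ ⇨ ⟦ φ₀ ∘ cod ⟧                ≈⟨ ⟦→̇⟧-reindex _→̇_ ⟦→̇⟧≈⇨ (λ w → ⋀̇ (dom w) , φ₀ (cod w)) ⟨
      ⟦ (λ w → _→̇_ (⋀̇ (dom w) , φ₀ (cod w))) ⟧  ≈⟨ Pm-resp-≗ ξ-is-arrow trΣ ⟩
      ⟦ element (φ̃₀ ∘ a⟶b) ⟧                    ∎)
      where
      module X = L X
      open L (Incidence (φ̃₀ ∘ a⟶b))
      ι : Incidence (φ̃₀ ∘ a⟶b) → X
      ι = index (φ̃₀ ∘ a⟶b)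
      witness : (w : Incidence (φ̃₀ ∘ a⟶b)) → ⟶-Witness (a (ι w)) (b (ι w)) (element (φ̃₀ ∘ a⟶b) w)
      witness w = φ̃₀-⟶-witness (a (ι w)) (b (ι w)) (element (φ̃₀ ∘ a⟶b) w) (proj₂ w)
      open module W w = ⟶-Witness (witness w)
      dom-bound : ⟦ ⋀̇ ∘ dom ⟧ ≤ ⟦ φ ∘ a ∘ ι ⟧
      dom-bound = ⋀̇-antitone (φ̃₀ ∘ a ∘ ι) dom φ̃₀a⊆dom
      cod-bound : ⟦ φ ∘ b ∘ ι ⟧ ≤ ⟦ φ₀ ∘ cod ⟧
      cod-bound = ⋀̇-lowerBound (φ̃₀ ∘ b ∘ ι) (φ₀ ∘ cod) (λ w → φ₀∈φ̃₀ (b (ι w)) (cod∈b w))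

    ⟦⟶⟧′≈⇨ : H._≈_ X ⟦ a⟶b ⟧' (H._⇨_ X ⟦ a ⟧' ⟦ b ⟧')
    ⟦⟶⟧′≈⇨ = begin-equality
      ⟦ a⟶b ⟧'               ≈⟨ Pm-⟦⟧ a⟶b φ ⟩
      ⟦ φ ∘ a⟶b ⟧            ≈⟨ antisym ⟦φ∘⟶⟧≤⇨ ⇨≤⟦φ∘⟶⟧ ⟩
      ⟦ φ ∘ a ⟧ ⇨ ⟦ φ ∘ b ⟧  ≈⟨ ⇨-cong (Pm-⟦⟧ a φ) (Pm-⟦⟧ b φ) ⟨
      ⟦ a ⟧' ⇨ ⟦ b ⟧'        ∎
      where open L X

proposition3p11 :
    {ℓ c ℓ₁ ℓ₂ : Level} (T : Tripos ℓ c ℓ₁ ℓ₂) (lem : LEM ℓ) (funext : Extensionality ℓ ℓ)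
    (_→̇_ : Tripos.Sig T × Tripos.Sig T → Tripos.Sig T) →
    Tripos.H._≈_ T (Tripos.Sig T × Tripos.Sig T) (Tripos.⟦_⟧ T _→̇_)
      (Tripos.H._⇨_ T (Tripos.Sig T × Tripos.Sig T) (Tripos.⟦_⟧ T proj₁) (Tripos.⟦_⟧ T proj₂)) →
    (⋀̇ : 𝔓 (Tripos.Sig T) → Tripos.Sig T) →
    Tripos.H._≈_ T (𝔓 (Tripos.Sig T)) (Tripos.⟦_⟧ T ⋀̇)
      (Tripos.∀m T (Construction.e₂ T lem _→̇_ ⋀̇) (Tripos.⟦_⟧ T (Construction.e₁ T lem _→̇_ ⋀̇))) →
    let open Construction T lem _→̇_ ⋀̇ in
    Tripos.H._≈_ T (𝒜 × 𝒜)
      (⟦ (λ (p : 𝒜 × 𝒜) → proj₁ p ⟶ proj₂ p) ⟧')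
      (Tripos.H._⇨_ T (𝒜 × 𝒜) (⟦ proj₁ ⟧') (⟦ proj₂ ⟧'))
proposition3p11 T lem _ _→̇_ ⟦→̇⟧≈⇨ ⋀̇ ⟦⋀̇⟧≈∀ =
  ArrowRealizability.⟦⟶⟧′≈⇨ T lem _→̇_ ⟦→̇⟧≈⇨ ⋀̇ ⟦⋀̇⟧≈∀ proj₁ proj₂
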